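{- Let $q$ be an odd prime power with $q \equiv 3 \pmod 4$, and let $V_q$ be the graph with vertex set $F_q^2$ in which distinct $X,Y$ are adjacent if and only if $Q(X,Y)$ is a nonzero square in $F_q$. If $U \subseteq F_q^2$ spans a complete subgraph or an edgeless subgraph of $V_q$, then $|U| \leq q$.
   Context: $F_q$ is the finite field with $q$ elements; the quadrance of $[x_1,y_1],[x_2,y_2] \in F_q^2$ is $Q = (x_2-x_1)^2 + (y_2-y_1)^2$. -}

module Defs where

open import Level using (Level; _⊔_)
open import Algebra.Bundles using (CommutativeRing)
open import Data.Nat using (ℕ; suc; _^_)
open import Data.Nat.Primality using (Prime)
open import Data.Fin using (Fin)
open import Data.Product using (Σ; ∃; _×_)
import Data.Product
open import Data.List using (List)
open import Data.List.Relation.Unary.AllPairs using (AllPairs)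
open import Relation.Nullary using (¬_)
open import Relation.Binary.Definitions using (Decidable)
open import Relation.Binary.PropositionalEquality using (_≡_)

IsPrimePower : ℕ → Set
IsPrimePower q = Σ ℕ λ p → Σ ℕ λ k → Prime p × q ≡ p ^ suc k

record IsFiniteField {c ℓ : Level} (R : CommutativeRing c ℓ) (q : ℕ) : Set (c ⊔ ℓ) where
  open CommutativeRing R
  field
    0≉1      : ¬ (0# ≈ 1#)
    inverse  : ∀ x → ¬ (x ≈ 0#) → ∃ λ y → x * y ≈ 1#
    _≟_      : Decidable _≈_
    enum     : Fin q → Carrier
    enum-inj : ∀ i j → enum i ≈ enum j → i ≡ j
    enum-sur : ∀ x → ∃ λ i → enum i ≈ x

module Plane {c ℓ : Level} (R : CommutativeRing c ℓ) where
  open CommutativeRing R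

  Point : Set c
  Point = Carrier × Carrier

  _≈ₚ_ : Point → Point → Set ℓ
  (x₁ Data.Product., y₁) ≈ₚ (x₂ Data.Product., y₂) = (x₁ ≈ x₂) × (y₁ ≈ y₂)

  quadrance : Point → Point → Carrier
  quadrance (x₁ Data.Product., y₁) (x₂ Data.Product., y₂) =
    ((x₂ - x₁) * (x₂ - x₁)) + ((y₂ - y₁) * (y₂ - y₁))

  IsNonzeroSquare : Carrier → Set (c ⊔ ℓ)
  IsNonzeroSquare a = ¬ (a ≈ 0#) × ∃ λ b → a ≈ b * b

  Adjacent : Point → Point → Set (c ⊔ ℓ)
  Adjacent X Y = ¬ (X ≈ₚ Y) × IsNonzeroSquare (quadrance X Y)

  -- a finite set U of points, given as a duplicate-free list
  Distinct : List Point → Set (c ⊔ ℓ)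
  Distinct U = AllPairs (λ X Y → ¬ (X ≈ₚ Y)) U

  IsClique : List Point → Set (c ⊔ ℓ)
  IsClique U = AllPairs Adjacent U

  IsIndependent : List Point → Set (c ⊔ ℓ)
  IsIndependent U = AllPairs (λ X Y → ¬ Adjacent X Y) U

{-# OPTIONS --safe #-}
module Submission where

open import Defs
open import Level using (Level; _⊔_)
open import Algebra.Bundles using (CommutativeRing)
open import Data.Nat as ℕ using (ℕ; zero; suc; _≤_; _%_; _≤?_; s<s)
open import Data.List using (List; length; lookup)
open import Data.Sum using (_⊎_; inj₁; inj₂)
open import Relation.Binary.PropositionalEquality using (_≡_)

open import Data.Nat.Properties using (≮⇒≥; n<1+n; +-suc; m≤n⇒∃[o]m+o≡n)
open import Data.Fin as Fin using (Fin; toℕ)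
open import Data.Fin.Properties using (pigeonhole)
open import Data.List.Membership.Propositional.Properties using (∈-lookup)
import Data.List.Relation.Unary.All as All
open import Data.List.Relation.Unary.AllPairs using (AllPairs; _∷_; zip)
open import Data.Product using (∃; _,_; proj₁; proj₂)
open import Function using (_∘_)
open import Relation.Binary.Core using (Rel)
open import Relation.Binary.PropositionalEquality using (_≢_)
import Relation.Binary.PropositionalEquality as ≡
open import Relation.Nullary.Negation using (¬_; ¬¬-map)
open import Relation.Nullary.Decidable using (decidable-stable)

-- Fix a slope a and sort the points by the line x = a y + c they lie on.  Two distinct points
-- on one such line differ by t (a , 1) with t ≠ 0, so their quadrance t² (a² + 1) is a nonzero
-- square exactly when a² + 1 is.  Hence, if a² + 1 is a nonzero square, an independent set meets
-- each of the q lines at most once, and if it is not, a clique does.  Slope 0 serves for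
-- independent sets.  For cliques some a² + 1 must fail to be a nonzero square: otherwise
-- induction makes every n · 1 a square, in particular -1 = b² in positive characteristic, and
-- then b² + 1 = 0.

module _ {a r} {A : Set a} {R : Rel A r} where

  allPairs-lookup : ∀ {xs} → AllPairs R xs →
                    ∀ {i j} → i Fin.< j → R (lookup xs i) (lookup xs j)
  allPairs-lookup (Rx ∷ _)  {Fin.zero}  {Fin.suc j} _         = All.lookup Rx (∈-lookup j)
  allPairs-lookup (_ ∷ Rxs) {Fin.suc i} {Fin.suc j} (s<s i<j) = allPairs-lookup Rxs i<j

  separated⇒length≤ : ∀ {n} (f : A → Fin n) → (∀ {x y} → R x y → f x ≢ f y) →
                      ∀ {xs} → AllPairs R xs → length xs ≤ n
  separated⇒length≤ f separates {xs} Rxs = ≮⇒≥ λ n<length →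
    let i , j , i<j , fᵢ≡fⱼ = pigeonhole n<length (f ∘ lookup xs)
    in  separates (allPairs-lookup Rxs i<j) fᵢ≡fⱼ

module CommutativeRingLemmas {c ℓ} (R : CommutativeRing c ℓ) where

  open CommutativeRing R
  open Plane R
  open import Algebra.Properties.Ring ring
    using (x∙y⁻¹≈ε⇒x≈y; xyx⁻¹≈y; //-rightDividesˡ; x[y-z]≈xy-xz)
  open import Algebra.Properties.Semiring.Mult semiring using (_×_)
  open import Algebra.Solver.Ring.NaturalCoefficients.Default commutativeSemiring
    using (solve; _:=_; _:+_; _:*_; con)
  open import Relation.Binary.Reasoning.Setoid setoid

  IsSquare : Carrier → Set (c ⊔ ℓ)
  IsSquare x = ∃ λ b → x ≈ b * b

  IsNonzeroSquare-resp : ∀ {x y} → x ≈ y → IsNonzeroSquare x → IsNonzeroSquare y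
  IsNonzeroSquare-resp x≈y (x≉0 , b , x≈b²) = x≉0 ∘ trans x≈y , b , trans (sym x≈y) x≈b²

  isNonzeroSquare-1# : ¬ 0# ≈ 1# → IsNonzeroSquare 1#
  isNonzeroSquare-1# 0≉1 = 0≉1 ∘ sym , 1# , sym (*-identityˡ 1#)

  positiveCharacteristic⇒¬¬nonsquareSlope : (∃ λ n → suc n × 1# ≈ 0#) →
    ¬ ¬ ∃ λ a → ¬ IsNonzeroSquare (a * a + 1#)
  positiveCharacteristic⇒¬¬nonsquareSlope (n , char) noSlope =
    multiples-square n λ (b , n≈b²) → all-square b λ (b²+1≉0 , _) → b²+1≉0 (begin
      b * b + 1#    ≈⟨ +-comm (b * b) 1# ⟩
      1# + b * b    ≈⟨ +-congˡ n≈b² ⟨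
      suc n × 1#    ≈⟨ char ⟩
      0#            ∎)
    where
    all-square : ∀ a → ¬ ¬ IsNonzeroSquare (a * a + 1#)
    all-square a ¬square = noSlope (a , ¬square)

    multiples-square : ∀ m → ¬ ¬ IsSquare (m × 1#)
    multiples-square zero    k = k (0# , sym (zeroˡ 0#))
    multiples-square (suc m) k =
      multiples-square m λ (b , m≈b²) → all-square b λ (_ , d , b²+1≈d²) → k (d , (begin
        1# + m × 1#   ≈⟨ +-congˡ m≈b² ⟩
        1# + b * b    ≈⟨ +-comm 1# (b * b) ⟩
        b * b + 1#    ≈⟨ b²+1≈d² ⟩
        d * d         ∎))

  x-u≈y-v⇒y-x≈v-u : ∀ {x u y v} → x - u ≈ y - v → y - x ≈ v - u
  x-u≈y-v⇒y-x≈v-u {x} {u} {y} {v} x-u≈y-v = begin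
    y - x                ≈⟨ +-congʳ (//-rightDividesˡ v y) ⟨
    ((y - v) + v) - x    ≈⟨ +-congʳ (+-congʳ x-u≈y-v) ⟨
    ((x - u) + v) - x    ≈⟨ +-congʳ (+-assoc x (- u) v) ⟩
    (x + (- u + v)) - x  ≈⟨ +-congʳ (+-congˡ (+-comm (- u) v)) ⟩
    (x + (v - u)) - x    ≈⟨ xyx⁻¹≈y x (v - u) ⟩
    v - u                ∎

  xIntercept : Carrier → Point → Carrier
  xIntercept a (x , y) = x - a * y

  module _ {a x₁ y₁ x₂ y₂} (same : xIntercept a (x₁ , y₁) ≈ xIntercept a (x₂ , y₂)) where

    sameXIntercept⇒dx≈a*dy : x₂ - x₁ ≈ a * (y₂ - y₁)
    sameXIntercept⇒dx≈a*dy = trans (x-u≈y-v⇒y-x≈v-u same) (sym (x[y-z]≈xy-xz a y₂ y₁))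

    sameXIntercept⇒quadrance : quadrance (x₁ , y₁) (x₂ , y₂) ≈ ((y₂ - y₁) * (y₂ - y₁)) * (a * a + 1#)
    sameXIntercept⇒quadrance = begin
      (x₂ - x₁) * (x₂ - x₁) + dy * dy  ≈⟨ +-congʳ (*-cong sameXIntercept⇒dx≈a*dy sameXIntercept⇒dx≈a*dy) ⟩
      (a * dy) * (a * dy) + dy * dy    ≈⟨ solve 2 (λ a t → (a :* t) :* (a :* t) :+ t :* t
                                                       := (t :* t) :* (a :* a :+ con 1)) refl a dy ⟩
      (dy * dy) * (a * a + 1#)         ∎
      where dy = y₂ - y₁

    sameXIntercept-distinct⇒dy≉0 : ¬ (x₁ , y₁) ≈ₚ (x₂ , y₂) → ¬ y₂ - y₁ ≈ 0#
    sameXIntercept-distinct⇒dy≉0 X≉Y dy≈0 = X≉Y (sym (x∙y⁻¹≈ε⇒x≈y x₂ x₁ dx≈0) , sym (x∙y⁻¹≈ε⇒x≈y y₂ y₁ dy≈0))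
      where
      dx≈0 : x₂ - x₁ ≈ 0#
      dx≈0 = trans sameXIntercept⇒dx≈a*dy (trans (*-congˡ dy≈0) (zeroʳ a))

  module Field (inverse : ∀ x → ¬ x ≈ 0# → ∃ λ y → x * y ≈ 1#) where

    *-nonzero : ∀ {x y} → ¬ x ≈ 0# → ¬ y ≈ 0# → ¬ x * y ≈ 0#
    *-nonzero {x} {y} x≉0 y≉0 xy≈0 with x⁻¹ , xx⁻¹≈1 ← inverse x x≉0 = y≉0 (begin
      y               ≈⟨ *-identityˡ y ⟨
      1# * y          ≈⟨ *-congʳ xx⁻¹≈1 ⟨
      (x * x⁻¹) * y   ≈⟨ solve 3 (λ x u y → (x :* u) :* y := u :* (x :* y)) refl x x⁻¹ y ⟩
      x⁻¹ * (x * y)   ≈⟨ *-congˡ xy≈0 ⟩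
      x⁻¹ * 0#        ≈⟨ zeroʳ x⁻¹ ⟩
      0#              ∎)

    scale-isNonzeroSquare : ∀ {t s} → ¬ t ≈ 0# → IsNonzeroSquare s → IsNonzeroSquare ((t * t) * s)
    scale-isNonzeroSquare {t} {s} t≉0 (s≉0 , w , s≈w²) =
      *-nonzero (*-nonzero t≉0 t≉0) s≉0 , t * w , (begin
        (t * t) * s        ≈⟨ *-congˡ s≈w² ⟩
        (t * t) * (w * w)  ≈⟨ solve 2 (λ t w → (t :* t) :* (w :* w) := (t :* w) :* (t :* w)) refl t w ⟩
        (t * w) * (t * w)  ∎)

    unscale-isNonzeroSquare : ∀ {t s} → ¬ t ≈ 0# → IsNonzeroSquare ((t * t) * s) → IsNonzeroSquare s
    unscale-isNonzeroSquare {t} {s} t≉0 (t²s≉0 , w , t²s≈w²) with t⁻¹ , tt⁻¹≈1 ← inverse t t≉0 =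
      (λ s≈0 → t²s≉0 (trans (*-congˡ s≈0) (zeroʳ (t * t)))) , t⁻¹ * w , (begin
        s                                  ≈⟨ *-identityˡ s ⟨
        1# * s                             ≈⟨ *-congʳ (*-identityˡ 1#) ⟨
        (1# * 1#) * s                      ≈⟨ *-congʳ (*-cong tt⁻¹≈1 tt⁻¹≈1) ⟨
        ((t * t⁻¹) * (t * t⁻¹)) * s        ≈⟨ solve 3 (λ t u s → ((t :* u) :* (t :* u)) :* s
                                                         := (u :* u) :* ((t :* t) :* s)) refl t t⁻¹ s ⟩
        (t⁻¹ * t⁻¹) * ((t * t) * s)        ≈⟨ *-congˡ t²s≈w² ⟩
        (t⁻¹ * t⁻¹) * (w * w)              ≈⟨ solve 2 (λ u w → (u :* u) :* (w :* w) := (u :* w) :* (u :* w)) refl t⁻¹ w ⟩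
        (t⁻¹ * w) * (t⁻¹ * w)              ∎)

    module _ {a X Y} (same : xIntercept a X ≈ xIntercept a Y) where

      sameXIntercept⇒adjacent⇒isNonzeroSquare : Adjacent X Y → IsNonzeroSquare (a * a + 1#)
      sameXIntercept⇒adjacent⇒isNonzeroSquare (X≉Y , nonzeroSquare) =
        unscale-isNonzeroSquare (sameXIntercept-distinct⇒dy≉0 same X≉Y)
          (IsNonzeroSquare-resp (sameXIntercept⇒quadrance same) nonzeroSquare)

      sameXIntercept⇒isNonzeroSquare⇒adjacent : ¬ X ≈ₚ Y → IsNonzeroSquare (a * a + 1#) → Adjacent X Y
      sameXIntercept⇒isNonzeroSquare⇒adjacent X≉Y nonzeroSquare =
        X≉Y , IsNonzeroSquare-resp (sym (sameXIntercept⇒quadrance same))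
                (scale-isNonzeroSquare (sameXIntercept-distinct⇒dy≉0 same X≉Y) nonzeroSquare)

module FiniteField {c ℓ} (R : CommutativeRing c ℓ) {q} (F : IsFiniteField R q) where

  open CommutativeRing R
  open Plane R
  open IsFiniteField F
  open CommutativeRingLemmas R
  open Field inverse
  open import Algebra.Properties.Ring ring using (+-identityʳ-unique)
  open import Algebra.Properties.Semiring.Mult semiring using (_×_; ×-homo-+)
  open import Relation.Binary.Reasoning.Setoid setoid

  index : Carrier → Fin q
  index x = proj₁ (enum-sur x)

  index-injective : ∀ {x y} → index x ≡ index y → x ≈ y
  index-injective {x} {y} eq =
    trans (sym (proj₂ (enum-sur x))) (trans (reflexive (≡.cong enum eq)) (proj₂ (enum-sur y)))

  separated⇒length≤q : ∀ {a r} {A : Set a} {S : Rel A r} (g : A → Carrier) →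
                       (∀ {X Y} → S X Y → ¬ g X ≈ g Y) → ∀ {xs} → AllPairs S xs → length xs ≤ q
  separated⇒length≤q g separates = separated⇒length≤ (index ∘ g) (λ S-XY → separates S-XY ∘ index-injective)

  positiveCharacteristic : ∃ λ n → suc n × 1# ≈ 0#
  positiveCharacteristic =
    let i , j , i<j , eq  = pigeonhole (n<1+n q) (λ k → index (toℕ k × 1#))
        o , 1+i+o≡j       = m≤n⇒∃[o]m+o≡n i<j
    in  o , +-identityʳ-unique (toℕ i × 1#) (suc o × 1#) (begin
          toℕ i × 1# + suc o × 1#  ≈⟨ ×-homo-+ 1# (toℕ i) (suc o) ⟨
          (toℕ i ℕ.+ suc o) × 1#   ≡⟨ ≡.cong (_× 1#) (≡.trans (+-suc (toℕ i) o) 1+i+o≡j) ⟩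
          toℕ j × 1#               ≈⟨ index-injective eq ⟨
          toℕ i × 1#               ∎)

  clique⇒length≤q : ∀ {U} → IsClique U → length U ≤ q
  clique⇒length≤q {U} clique =
    decidable-stable (length U ≤? q) (¬¬-map bound (positiveCharacteristic⇒¬¬nonsquareSlope positiveCharacteristic))
    where
    bound : (∃ λ a → ¬ IsNonzeroSquare (a * a + 1#)) → length U ≤ q
    bound (a , nonsquare) = separated⇒length≤q (xIntercept a)
      (λ adjacent same → nonsquare (sameXIntercept⇒adjacent⇒isNonzeroSquare same adjacent)) clique

  independent⇒length≤q : ∀ {U} → Distinct U → IsIndependent U → length U ≤ q
  independent⇒length≤q distinct independent = separated⇒length≤q (xIntercept 0#)
    (λ (X≉Y , ¬adjacent) same → ¬adjacent (sameXIntercept⇒isNonzeroSquare⇒adjacent same X≉Y 0²+1-square))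
    (zip (distinct , independent))
    where
    0²+1-square : IsNonzeroSquare (0# * 0# + 1#)
    0²+1-square = IsNonzeroSquare-resp (sym (trans (+-congʳ (zeroˡ 0#)) (+-identityˡ 1#))) (isNonzeroSquare-1# 0≉1)

mainTheorem7 : {c ℓ : Level} (R : CommutativeRing c ℓ) (q : ℕ) →
    IsFiniteField R q → IsPrimePower q → q % 2 ≡ 1 → q % 4 ≡ 3 →
    (U : List (Plane.Point R)) → Plane.Distinct R U →
    Plane.IsClique R U ⊎ Plane.IsIndependent R U →
    length U ≤ q
mainTheorem7 R q F _ _ _ _ _        (inj₁ clique)      = FiniteField.clique⇒length≤q R F clique
mainTheorem7 R q F _ _ _ _ distinct (inj₂ independent) = FiniteField.independent⇒length≤q R F distinct independent
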